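{- Let $A$ be a finite ordered set, and $R$ a commutative unital ring. The exterior algebra $\Lambda(RA)$ injects, as an algebra, into the Hochschild cohomology $H^*(\mathbf{Pl}_A; R)$ of the plactic monoid on $A$, via the map $a \mapsto \zeta_a$.
   Context: $\mathbf{Pl}_A$ is the plactic monoid, the quotient of the free monoid $A^*$ by the Knuth relations $xzy \sim zxy$ for $x \le y < z$ and $yxz \sim yzx$ for $x < y \le z$. $H^*(\mathbf{Pl}_A;R)$ denotes Hochschild cohomology with trivial coefficients, i.e. with coefficients in $R$ where both actions of $\mathbf{Pl}_A$ are given by the constant character $\varepsilon_1\equiv 1_R$, with the usual cup product. $RA$ is the free $R$-module on $A$. For $a\in A$, $\zeta_a\colon \mathbf{Pl}_A \to R$ sends a word to the number of occurrences of the letter $a$ in it (times $1_R$); it is invariant under Knuth equivalence, additive, and the $\zeta_a$ form a basis of $H^1(\mathbf{Pl}_A;R)$. -}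

module Defs where

open import Level using (_⊔_; Lift)
open import Data.Nat using (ℕ; zero; suc) renaming (_+_ to _+ℕ_)
open import Data.Fin using (Fin; zero; suc; _≤_; _<_; _≟_)
open import Data.List using (List; []; _∷_; _++_; filter; length)
open import Data.List.Relation.Unary.Linked using (Linked)
open import Data.Vec using (Vec; []; _∷_; take; drop; toList)
import Data.Vec as Vec
open import Data.Vec.Relation.Binary.Pointwise.Inductive using (Pointwise)
open import Data.Product using (Σ; _×_)
open import Algebra.Bundles using (CommutativeRing)
open import Relation.Binary.Construct.Closure.Equivalence using (EqClosure)

-- The finite ordered set A is taken to be Fin n with its usual (total) order.
-- Words over A: elements of the free monoid A*.
Word : ℕ → Set
Word n = List (Fin n)

data KnuthStep {n : ℕ} : Word n → Word n → Set where
  knuth₁ : ∀ (u v : Word n) {x y z : Fin n} → x ≤ y → y < z →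
           KnuthStep (u ++ (x ∷ z ∷ y ∷ []) ++ v) (u ++ (z ∷ x ∷ y ∷ []) ++ v)
  knuth₂ : ∀ (u v : Word n) {x y z : Fin n} → x < y → y ≤ z →
           KnuthStep (u ++ (y ∷ x ∷ z ∷ []) ++ v) (u ++ (y ∷ z ∷ x ∷ []) ++ v)

-- Knuth (plactic) equivalence: the congruence on A* generated by the Knuth
-- relations; words modulo it are the elements of the plactic monoid Pl_A.
_≈K_ : {n : ℕ} → Word n → Word n → Set
_≈K_ = EqClosure KnuthStep

-- Strictly increasing sequences a₁ < ... < a_k of letters (basis of Λ^k(RA)).
StrictlyIncreasing : {n k : ℕ} → Vec (Fin n) k → Set
StrictlyIncreasing as = Linked _<_ (toList as)

-- Merge positions i and i+1 of a tuple (the inner face maps of the bar complex).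
merge : {A : Set} → {k : ℕ} → Fin k → Vec (List A) (suc k) → Vec (List A) k
merge zero    (x ∷ y ∷ xs) = (x ++ y) ∷ xs
merge (suc i) (x ∷ xs)     = x ∷ merge i xs

module Hochschild {c ℓ} (R : CommutativeRing c ℓ) (n : ℕ) where
  open CommutativeRing R using (Carrier; _≈_; _+_; _*_; -_; 0#; 1#)

  -- k-cochains: maps Pl_A^k → R, represented as maps on k-tuples of words
  -- that are invariant under Knuth equivalence in every argument.
  Cochain : ℕ → Set c
  Cochain k = Vec (Word n) k → Carrier

  Invariant : {k : ℕ} → Cochain k → Set ℓ
  Invariant {k} f = ∀ (ms ms' : Vec (Word n) k) → Pointwise _≈K_ ms ms' → f ms ≈ f ms'

  sign : ℕ → Carrier
  sign zero    = 1#
  sign (suc m) = - sign m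

  sumFin : {k : ℕ} → (Fin k → Carrier) → Carrier
  sumFin {zero}  F = 0#
  sumFin {suc k} F = F zero + sumFin (λ i → F (suc i))

  -- Hochschild coboundary with trivial coefficients (both actions via ε ≡ 1):
  -- (δf)(m₀,…,m_k) = f(m₁,…,m_k) + Σ_{i<k} (-1)^{i+1} f(…,m_i m_{i+1},…)
  --                  + (-1)^{k+1} f(m₀,…,m_{k-1})
  δ : {k : ℕ} → Cochain k → Cochain (suc k)
  δ {k} f ms =
    f (Vec.tail ms)
    + sumFin (λ (i : Fin k) → sign (suc (Data.Fin.toℕ i)) * f (merge i ms))
    + sign (suc k) * f (Vec.init ms)

  _∪_ : {p q : ℕ} → Cochain p → Cochain q → Cochain (p +ℕ q)
  _∪_ {p} f g ms = f (take p ms) * g (drop p ms)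

  -- Cocycles / coboundaries (C^{-1} = 0, so in degree 0 coboundary means zero).
  IsCocycle : {k : ℕ} → Cochain k → Set ℓ
  IsCocycle f = ∀ ms → δ f ms ≈ 0#

  IsCoboundary : (k : ℕ) → Cochain k → Set (c ⊔ ℓ)
  IsCoboundary zero    f = Lift c (∀ ms → f ms ≈ 0#)
  IsCoboundary (suc j) f = Σ (Cochain j) λ g → Invariant g × (∀ ms → δ g ms ≈ f ms)

  fromℕ : ℕ → Carrier
  fromℕ zero    = 0#
  fromℕ (suc m) = 1# + fromℕ m

  ζ : Fin n → Cochain 1
  ζ a (w ∷ []) = fromℕ (length (filter (_≟ a) w))

  -- ζ_{a₁} ∪ ⋯ ∪ ζ_{a_k}  (image of a₁ ∧ ⋯ ∧ a_k); empty product is the unit 1.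
  ζ* : {k : ℕ} → Vec (Fin n) k → Cochain k
  ζ* []       _  = 1#
  ζ* (a ∷ as)    = ζ a ∪ ζ* as

  sumTuples : (k : ℕ) → (Vec (Fin n) k → Carrier) → Carrier
  sumTuples zero    F = F []
  sumTuples (suc k) F = sumFin (λ a → sumTuples k (λ as → F (a ∷ as)))

{-# OPTIONS --safe #-}
-- Each ζ_a is additive on words, hence a 1-cocycle. For x = Σ r_a ζ_a, the second elementary
-- symmetric function e₂(w) = Σ_{i<j} x(w_i) x(w_j) of the letters of w is invariant under permuting
-- letters, hence under Knuth moves, and δ(-e₂) = x ∪ x.
-- For injectivity, evaluate cochains on the signed shuffle product [x₁] ⧢ ⋯ ⧢ [x_k] of 1-chains: when
-- the x_i commute pairwise in Pl_A it is a cycle, so it annihilates coboundaries. For s₁ < ⋯ < s_k take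
-- x_i to be the column word s_k ⋯ s_i. Nested columns commute in Pl_A, and ζ_{s_i}(x_i) = 1 while
-- ζ_{s_i}(x_j) = 0 for j > i, so on this cycle Σ_T c_T ζ_T takes the value c_S.
module Submission where

open import Defs
open import Level using (lift)
open import Data.Nat as ℕ using (ℕ; zero; suc)
import Data.Nat.Properties as ℕ
open import Data.Fin as Fin using (Fin; _<_; _≤_; _>_; _≟_)
import Data.Fin.Properties as Fin
open import Data.List using (List; []; _∷_; _++_; [_]; filter; length)
open import Data.List.Properties using (++-assoc; ++-identityʳ; filter-++; filter-none; filter-all; length-++)
open import Data.List.Membership.Propositional using (_∈_; _∉_)
open import Data.List.Relation.Unary.All as All using (All; []; _∷_)
import Data.List.Relation.Unary.All.Properties as All
open import Data.List.Relation.Unary.AllPairs using (AllPairs; []; _∷_)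
import Data.List.Relation.Unary.AllPairs.Properties as AllPairs
open import Data.List.Relation.Unary.Any as Any using (here; there)
open import Data.List.Relation.Unary.Linked as Linked using (Linked; []; [-]; _∷_; linked?)
open import Data.List.Relation.Unary.Linked.Properties using (AllPairs⇒Linked; Linked⇒AllPairs)
open import Data.List.Relation.Binary.Sublist.Heterogeneous using (Sublist; minimum; _∷_; _∷ʳ_)
open import Data.List.Relation.Binary.Sublist.Heterogeneous.Properties using (toPointwise)
open import Data.List.Relation.Binary.Pointwise using (Pointwise-≡⇒≡)
open import Data.Vec as Vec using (Vec; []; _∷_; toList)
import Data.Vec.Properties as Vec
open import Data.Vec.Relation.Binary.Equality.Cast using (cast-is-id)
open import Data.Vec.Membership.Propositional using () renaming (_∈_ to _∈ᵥ_)
open import Data.Vec.Relation.Unary.Any using (here; there)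
open import Data.Vec.Relation.Unary.All as VecAll using ([]; _∷_) renaming (All to VecAll)
open import Data.Vec.Relation.Unary.AllPairs as VecAllPairs using ([]; _∷_)
open import Data.Vec.Relation.Binary.Pointwise.Inductive as Pointwise using (Pointwise; []; _∷_)
open import Data.Product using (Σ; _×_; _,_)
open import Data.Sum using (_⊎_; inj₁; inj₂)
open import Data.Unit using (⊤; tt)
open import Data.Empty using (⊥-elim)
open import Data.Integer as ℤ using (ℤ; +_; -[1+_]; _⊖_)
open import Data.Integer.Properties using ([1+m]⊖[1+n]≡m⊖n)
open import Data.Sign as Sign using (Sign)
open import Data.Maybe using (Maybe; just; nothing)
open import Function using (_∘_; id)
open import Relation.Nullary using (¬_; yes; no)
open import Relation.Binary.Bundles using (Setoid)
open import Relation.Binary.PropositionalEquality as ≡ using (_≡_; _≢_)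
import Relation.Binary.Construct.Closure.Equivalence as EqClosure
open import Algebra.Bundles using (CommutativeRing)
open import Algebra.Solver.Ring.AlmostCommutativeRing using (fromCommutativeRing; _-Raw-AlmostCommutative⟶_)

module ℤ-Solver {c ℓ} (R : CommutativeRing c ℓ) where
  open CommutativeRing R
  open import Algebra.Properties.Ring ring using (-0#≈0#; -‿involutive; -1*x≈-x; -‿distribʳ-*; -‿+-comm)
  -- This _×_ has 1 × x = x definitionally, so that the solver's constants ±1 are 1# and - 1# on the nose.
  open import Algebra.Properties.Semiring.Mult.TCOptimised semiring
    using (1+×; ×-homo-+; ×1-homo-*) renaming (_×_ to _×ₙ_)
  open import Algebra.Properties.CommutativeSemigroup +-commutativeSemigroup
    using () renaming (interchange to +-interchange)
  open import Algebra.Properties.CommutativeSemigroup *-commutativeSemigroup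
    using () renaming (interchange to *-interchange)
  open import Relation.Binary.Reasoning.Setoid setoid

  ⟦_⟧ : ℤ → Carrier
  ⟦ + n ⟧      = n ×ₙ 1#
  ⟦ -[1+ n ] ⟧ = - (suc n ×ₙ 1#)

  ⊖-homo : ∀ m n → ⟦ m ⊖ n ⟧ ≈ m ×ₙ 1# + - (n ×ₙ 1#)
  ⊖-homo m    zero    = sym (trans (+-congˡ -0#≈0#) (+-identityʳ _))
  ⊖-homo zero (suc n) = sym (+-identityˡ _)
  ⊖-homo (suc m) (suc n) = begin
    ⟦ suc m ⊖ suc n ⟧                      ≡⟨ ≡.cong ⟦_⟧ ([1+m]⊖[1+n]≡m⊖n m n) ⟩
    ⟦ m ⊖ n ⟧                              ≈⟨ ⊖-homo m n ⟩
    m ×ₙ 1# + - (n ×ₙ 1#)                  ≈⟨ +-identityˡ _ ⟨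
    0# + (m ×ₙ 1# + - (n ×ₙ 1#))           ≈⟨ +-congʳ (-‿inverseʳ 1#) ⟨
    (1# + - 1#) + (m ×ₙ 1# + - (n ×ₙ 1#))  ≈⟨ +-interchange 1# (- 1#) _ _ ⟩
    (1# + m ×ₙ 1#) + (- 1# + - (n ×ₙ 1#))  ≈⟨ +-congˡ (-‿+-comm 1# (n ×ₙ 1#)) ⟩
    (1# + m ×ₙ 1#) + - (1# + n ×ₙ 1#)      ≈⟨ +-cong (1+× m 1#) (-‿cong (1+× n 1#)) ⟨
    suc m ×ₙ 1# + - (suc n ×ₙ 1#)          ∎

  +-homo : ∀ i j → ⟦ i ℤ.+ j ⟧ ≈ ⟦ i ⟧ + ⟦ j ⟧
  +-homo -[1+ m ] -[1+ n ] = begin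
    - (suc (suc (m ℕ.+ n)) ×ₙ 1#)      ≡⟨ ≡.cong (λ k → - (suc k ×ₙ 1#)) (ℕ.+-suc m n) ⟨
    - ((suc m ℕ.+ suc n) ×ₙ 1#)        ≈⟨ -‿cong (×-homo-+ 1# (suc m) (suc n)) ⟩
    - (suc m ×ₙ 1# + suc n ×ₙ 1#)      ≈⟨ -‿+-comm _ _ ⟨
    - (suc m ×ₙ 1#) + - (suc n ×ₙ 1#)  ∎
  +-homo -[1+ m ] (+ n)    = trans (⊖-homo n (suc m)) (+-comm _ _)
  +-homo (+ m)    -[1+ n ] = ⊖-homo m (suc n)
  +-homo (+ m)    (+ n)    = ×-homo-+ 1# m n

  σ : Sign → Carrier
  σ Sign.+ = 1#
  σ Sign.- = - 1#

  σ-homo : ∀ s t → σ (s Sign.* t) ≈ σ s * σ t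
  σ-homo Sign.+ t      = sym (*-identityˡ _)
  σ-homo Sign.- Sign.+ = sym (*-identityʳ _)
  σ-homo Sign.- Sign.- = begin
    1#             ≈⟨ -‿involutive 1# ⟨
    - (- 1#)       ≈⟨ -‿cong (-1*x≈-x 1#) ⟨
    - (- 1# * 1#)  ≈⟨ -‿distribʳ-* _ _ ⟩
    - 1# * - 1#    ∎

  ◃-homo : ∀ s n → ⟦ s ℤ.◃ n ⟧ ≈ σ s * (n ×ₙ 1#)
  ◃-homo s      zero    = sym (zeroʳ _)
  ◃-homo Sign.+ (suc n) = sym (*-identityˡ _)
  ◃-homo Sign.- (suc n) = sym (-1*x≈-x _)

  signAbs-homo : ∀ i → ⟦ i ⟧ ≈ σ (ℤ.sign i) * (ℤ.∣ i ∣ ×ₙ 1#)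
  signAbs-homo (+ n)    = sym (*-identityˡ _)
  signAbs-homo -[1+ n ] = sym (-1*x≈-x _)

  *-homo : ∀ i j → ⟦ i ℤ.* j ⟧ ≈ ⟦ i ⟧ * ⟦ j ⟧
  *-homo i j = begin
    ⟦ (s Sign.* t) ℤ.◃ (m ℕ.* n) ⟧         ≈⟨ ◃-homo (s Sign.* t) (m ℕ.* n) ⟩
    σ (s Sign.* t) * ((m ℕ.* n) ×ₙ 1#)     ≈⟨ *-cong (σ-homo s t) (×1-homo-* m n) ⟩
    (σ s * σ t) * ((m ×ₙ 1#) * (n ×ₙ 1#))  ≈⟨ *-interchange _ _ _ _ ⟩
    (σ s * (m ×ₙ 1#)) * (σ t * (n ×ₙ 1#))  ≈⟨ *-cong (signAbs-homo i) (signAbs-homo j) ⟨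
    ⟦ i ⟧ * ⟦ j ⟧                          ∎
    where
    s t : Sign
    s = ℤ.sign i; t = ℤ.sign j
    m n : ℕ
    m = ℤ.∣ i ∣; n = ℤ.∣ j ∣

  -‿homo : ∀ i → ⟦ ℤ.- i ⟧ ≈ - ⟦ i ⟧
  -‿homo (+ zero) = sym -0#≈0#
  -‿homo (+ suc n)  = refl
  -‿homo -[1+ n ]   = sym (-‿involutive _)

  ℤ-homomorphism : ℤ.+-*-rawRing -Raw-AlmostCommutative⟶ fromCommutativeRing R
  ℤ-homomorphism = record
    { ⟦_⟧ = ⟦_⟧ ; +-homo = +-homo ; *-homo = *-homo ; -‿homo = -‿homo
    ; 0-homo = refl ; 1-homo = refl }

  ≟-sound : ∀ i j → Maybe (⟦ i ⟧ ≈ ⟦ j ⟧)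
  ≟-sound i j with i ℤ.≟ j
  ... | yes ≡.refl = just refl
  ... | no _     = nothing

  open import Algebra.Solver.Ring ℤ.+-*-rawRing (fromCommutativeRing R) ℤ-homomorphism ≟-sound
    using (solve; _:=_; _:+_; _:*_; :-_; con) public

module Plactic {n : ℕ} where
  open import Relation.Binary.Reasoning.Setoid (EqClosure.setoid (KnuthStep {n}))

  ≈K-refl : {w : Word n} → w ≈K w
  ≈K-refl = EqClosure.reflexive KnuthStep

  ≈K-reflexive : {w w' : Word n} → w ≡ w' → w ≈K w'
  ≈K-reflexive ≡.refl = ≈K-refl

  knuthStep-++ˡ : ∀ u {w w' : Word n} → KnuthStep w w' → KnuthStep (u ++ w) (u ++ w')
  knuthStep-++ˡ u (knuth₁ u₀ v x≤y y<z) =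
    ≡.subst₂ KnuthStep (++-assoc u u₀ _) (++-assoc u u₀ _) (knuth₁ (u ++ u₀) v x≤y y<z)
  knuthStep-++ˡ u (knuth₂ u₀ v x<y y≤z) =
    ≡.subst₂ KnuthStep (++-assoc u u₀ _) (++-assoc u u₀ _) (knuth₂ (u ++ u₀) v x<y y≤z)

  knuthStep-++ʳ : ∀ v {w w' : Word n} → KnuthStep w w' → KnuthStep (w ++ v) (w' ++ v)
  knuthStep-++ʳ v (knuth₁ u v₀ {x} {y} {z} x≤y y<z) =
    ≡.subst₂ KnuthStep (≡.sym (++-assoc u (x ∷ z ∷ y ∷ v₀) v)) (≡.sym (++-assoc u (z ∷ x ∷ y ∷ v₀) v))
      (knuth₁ u (v₀ ++ v) x≤y y<z)
  knuthStep-++ʳ v (knuth₂ u v₀ {x} {y} {z} x<y y≤z) =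
    ≡.subst₂ KnuthStep (≡.sym (++-assoc u (y ∷ x ∷ z ∷ v₀) v)) (≡.sym (++-assoc u (y ∷ z ∷ x ∷ v₀) v))
      (knuth₂ u (v₀ ++ v) x<y y≤z)

  ≈K-++ˡ : ∀ u {w w' : Word n} → w ≈K w' → (u ++ w) ≈K (u ++ w')
  ≈K-++ˡ u = EqClosure.gmap (u ++_) (knuthStep-++ˡ u)

  ≈K-++ʳ : ∀ v {w w' : Word n} → w ≈K w' → (w ++ v) ≈K (w' ++ v)
  ≈K-++ʳ v = EqClosure.gmap (_++ v) (knuthStep-++ʳ v)

  -- Both Knuth relations transpose two adjacent letters.
  transposition-invariant⇒≈K-invariant : ∀ {a ℓ} (S : Setoid a ℓ) (φ : Word n → Setoid.Carrier S) →
    (∀ u p q v → Setoid._≈_ S (φ (u ++ p ∷ q ∷ v)) (φ (u ++ q ∷ p ∷ v))) →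
    ∀ {w w'} → w ≈K w' → Setoid._≈_ S (φ w) (φ w')
  transposition-invariant⇒≈K-invariant S φ swap = EqClosure.gfold isEquivalence φ step
    where
    open Setoid S
    step : ∀ {w w'} → KnuthStep w w' → φ w ≈ φ w'
    step (knuth₁ u v {x} {y} {z} _ _) = swap u x z (y ∷ v)
    step (knuth₂ u v {x} {y} {z} _ _) =
      ≡.subst₂ (λ w w' → φ w ≈ φ w') (++-assoc u [ y ] _) (++-assoc u [ y ] _) (swap (u ++ [ y ]) x z v)

  Commute : Word n → Word n → Set
  Commute u v = (u ++ v) ≈K (v ++ u)

  slide-behind-head : ∀ {p z} (w : Word n) → Linked _>_ (p ∷ w) → p ≤ z → (p ∷ w ++ [ z ]) ≈K (p ∷ z ∷ w)
  slide-behind-head []      _           _   = ≈K-refl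
  slide-behind-head {p} {z} (x ∷ w) (p>x ∷ p∷w↓) p≤z = begin
    p ∷ x ∷ w ++ [ z ]  ≈⟨ ≈K-++ˡ [ p ] (slide-behind-head w p∷w↓ (ℕ.<⇒≤ (ℕ.<-≤-trans p>x p≤z))) ⟩
    p ∷ x ∷ z ∷ w       ≈⟨ EqClosure.return (knuth₂ [] w p>x p≤z) ⟩
    p ∷ z ∷ x ∷ w       ∎

  double : Word n → Word n
  double []      = []
  double (x ∷ w) = x ∷ x ∷ double w

  decreasing-++-prefix : ∀ (U L : Word n) → Linked _>_ (U ++ L) → (U ++ L ++ U) ≈K (double U ++ L)
  decreasing-++-prefix []      L _  = ≈K-reflexive (++-identityʳ L)
  decreasing-++-prefix (u ∷ U) L UL↓ = begin
    u ∷ U ++ L ++ u ∷ U           ≡⟨ ≡.cong (u ∷_) reassociate ⟩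
    (u ∷ (U ++ L) ++ [ u ]) ++ U  ≈⟨ ≈K-++ʳ U (slide-behind-head (U ++ L) UL↓ Fin.≤-refl) ⟩
    u ∷ u ∷ (U ++ L) ++ U         ≡⟨ ≡.cong (λ w → u ∷ u ∷ w) (++-assoc U L U) ⟩
    u ∷ u ∷ U ++ L ++ U           ≈⟨ ≈K-++ˡ (u ∷ u ∷ []) (decreasing-++-prefix U L (Linked.tail UL↓)) ⟩
    u ∷ u ∷ double U ++ L         ∎
    where
    reassociate : U ++ L ++ u ∷ U ≡ ((U ++ L) ++ [ u ]) ++ U
    reassociate = ≡.sym (≡.trans (++-assoc (U ++ L) [ u ] U) (++-assoc U L (u ∷ U)))

  Linked-++⁻ˡ : ∀ {R : Fin n → Fin n → Set} (U : Word n) {L} → Linked R (U ++ L) → Linked R U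
  Linked-++⁻ˡ []          _          = []
  Linked-++⁻ˡ (u ∷ [])    _          = [-]
  Linked-++⁻ˡ (u ∷ v ∷ U) (Ruv ∷ UL) = Ruv ∷ Linked-++⁻ˡ (v ∷ U) UL

  decreasing-prefix-commutes : ∀ (U L : Word n) → Linked _>_ (U ++ L) → Commute (U ++ L) U
  decreasing-prefix-commutes U L UL↓ = begin
    (U ++ L) ++ U          ≡⟨ ++-assoc U L U ⟩
    U ++ L ++ U            ≈⟨ decreasing-++-prefix U L UL↓ ⟩
    double U ++ L          ≡⟨ ≡.cong (_++ L) (++-identityʳ (double U)) ⟨
    (double U ++ []) ++ L  ≈⟨ ≈K-++ʳ L (decreasing-++-prefix U [] U↓) ⟨
    (U ++ U) ++ L          ≡⟨ ++-assoc U U L ⟩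
    U ++ U ++ L            ∎
    where
    U↓ : Linked _>_ (U ++ [])
    U↓ = ≡.subst (Linked _>_) (≡.sym (++-identityʳ U)) (Linked-++⁻ˡ U UL↓)

  column : List (Fin n) → Word n
  column []      = []
  column (s ∷ S) = column S ++ [ s ]

  column-All : ∀ {P : Fin n → Set} {S} → All P S → All P (column S)
  column-All []         = []
  column-All (ps ∷ pS) = All.++⁺ (column-All pS) (ps ∷ [])

  column-decreasing : ∀ {S} → AllPairs _<_ S → AllPairs _>_ (column S)
  column-decreasing []            = []
  column-decreasing (s<S ∷ S↑) =
    AllPairs.++⁺ (column-decreasing S↑) ([] ∷ []) (column-All (All.map (_∷ []) s<S))

  columns : ∀ {k} → Vec (Fin n) k → Vec (Word n) k
  columns []      = []
  columns (s ∷ S) = column (s ∷ toList S) ∷ columns S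

  columns-All : ∀ {P : Fin n → Set} {k} {S : Vec (Fin n) k} → All P (toList S) → VecAll (All P) (columns S)
  columns-All {S = []}    []         = []
  columns-All {S = s ∷ S} (ps ∷ pS) = column-All (ps ∷ pS) ∷ columns-All pS

  columns-prefixes : ∀ {k} (S : Vec (Fin n) k) →
    VecAll (λ w → Σ (Word n) λ L → column (toList S) ≡ w ++ L) (columns S)
  columns-prefixes []      = []
  columns-prefixes (s ∷ S) =
    ([] , ≡.sym (++-identityʳ _)) ∷ VecAll.map extend (columns-prefixes S)
    where
    extend : ∀ {w} → Σ (Word n) (λ L → column (toList S) ≡ w ++ L) →
             Σ (Word n) (λ L → column (s ∷ toList S) ≡ w ++ L)
    extend {w} (L , S≡wL) = L ++ [ s ] , ≡.trans (≡.cong (_++ [ s ]) S≡wL) (++-assoc w L [ s ])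

  columns-commute : ∀ {k} (S : Vec (Fin n) k) → AllPairs _<_ (toList S) → VecAllPairs.AllPairs Commute (columns S)
  columns-commute []      []           = []
  columns-commute (s ∷ S) (s<S ∷ S↑) =
    VecAll.map commute (columns-prefixes S) ∷ columns-commute S S↑
    where
    commute : ∀ {w} → Σ (Word n) (λ L → column (toList S) ≡ w ++ L) → Commute (column (s ∷ toList S)) w
    commute {w} (L , S≡wL) = ≡.subst (λ x → Commute x w) (≡.sym sS≡wLs)
      (decreasing-prefix-commutes w (L ++ [ s ])
        (≡.subst (Linked _>_) sS≡wLs (AllPairs⇒Linked (column-decreasing (s<S ∷ S↑)))))
      where
      sS≡wLs : column (s ∷ toList S) ≡ w ++ L ++ [ s ]
      sS≡wLs = ≡.trans (≡.cong (_++ [ s ]) S≡wL) (++-assoc w L [ s ])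

module IncreasingSequences {n : ℕ} where

  ∈-∷⁻ : ∀ {x s} {S : List (Fin n)} → s < x → x ∈ s ∷ S → x ∈ S
  ∈-∷⁻ s<x = Any.tail (λ x≡s → Fin.<-irrefl (≡.sym x≡s) s<x)

  ⊆⇒Sublist : ∀ (T S : List (Fin n)) → AllPairs _<_ T → AllPairs _<_ S → All (_∈ S) T → Sublist _≡_ T S
  ⊆⇒Sublist []      S       _            _            _                  = minimum S
  ⊆⇒Sublist (t ∷ T) []      _            _            (() ∷ _)
  ⊆⇒Sublist (t ∷ T) (s ∷ S) (t<T ∷ T↑) (_ ∷ S↑)   (here t≡s ∷ T⊆sS) =
    t≡s ∷ ⊆⇒Sublist T S T↑ S↑ (All.zipWith (λ (t<x , x∈sS) → ∈-∷⁻ (≡.subst (_< _) t≡s t<x) x∈sS) (t<T , T⊆sS))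
  ⊆⇒Sublist (t ∷ T) (s ∷ S) (t<T ∷ T↑) (s<S ∷ S↑) (there t∈S ∷ T⊆sS) =
    s ∷ʳ ⊆⇒Sublist (t ∷ T) S (t<T ∷ T↑) S↑
      (t∈S ∷ All.zipWith (λ (t<x , x∈sS) → ∈-∷⁻ (Fin.<-trans (All.lookup s<S t∈S) t<x) x∈sS) (t<T , T⊆sS))

  increasing-⊆⇒≡ : ∀ {k} (T S : Vec (Fin n) k) → AllPairs _<_ (toList T) → AllPairs _<_ (toList S) →
                   All (_∈ toList S) (toList T) → T ≡ S
  increasing-⊆⇒≡ T S T↑ S↑ T⊆S = ≡.trans (≡.sym (cast-is-id ≡.refl T)) (Vec.toList-injective ≡.refl T S
    (Pointwise-≡⇒≡ (toPointwise (≡.trans (Vec.length-toList T) (≡.sym (Vec.length-toList S)))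
                                 (⊆⇒Sublist _ _ T↑ S↑ T⊆S))))

module Cohomology {c ℓ} (R : CommutativeRing c ℓ) (n : ℕ) where
  open CommutativeRing R
  open Hochschild R n
  open ℤ-Solver R using (solve; _:=_; _:+_; _:*_; :-_; con)
  open import Algebra.Properties.Ring ring using (-0#≈0#; -‿+-comm; -‿distribˡ-*)
  open import Algebra.Properties.CommutativeSemigroup +-commutativeSemigroup
    using () renaming (interchange to +-interchange)
  open import Data.List.Membership.DecPropositional (Fin._≟_ {n}) using (_∈?_)
  open import Relation.Binary.Reasoning.Setoid setoid
  open Plactic {n}
  open IncreasingSequences {n}

  sumFin-cong : ∀ {k} (f g : Fin k → Carrier) → (∀ i → f i ≈ g i) → sumFin f ≈ sumFin g
  sumFin-cong {zero}  f g f≈g = refl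
  sumFin-cong {suc k} f g f≈g = +-cong (f≈g Fin.zero) (sumFin-cong (f ∘ Fin.suc) (g ∘ Fin.suc) (f≈g ∘ Fin.suc))

  sumFin-+ : ∀ {k} (f g : Fin k → Carrier) → sumFin (λ i → f i + g i) ≈ sumFin f + sumFin g
  sumFin-+ {zero}  f g = sym (+-identityʳ 0#)
  sumFin-+ {suc k} f g = trans (+-congˡ (sumFin-+ (f ∘ Fin.suc) (g ∘ Fin.suc))) (+-interchange _ _ _ _)

  sumFin-neg : ∀ {k} (f : Fin k → Carrier) → sumFin (λ i → - f i) ≈ - sumFin f
  sumFin-neg {zero}  f = sym -0#≈0#
  sumFin-neg {suc k} f = trans (+-congˡ (sumFin-neg (f ∘ Fin.suc))) (-‿+-comm _ _)

  sumFin-zero : ∀ {k} (f : Fin k → Carrier) → (∀ i → f i ≈ 0#) → sumFin f ≈ 0#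
  sumFin-zero {zero}  f f≈0 = refl
  sumFin-zero {suc k} f f≈0 =
    trans (+-cong (f≈0 Fin.zero) (sumFin-zero (f ∘ Fin.suc) (f≈0 ∘ Fin.suc))) (+-identityʳ 0#)

  sumFin-single : ∀ {k} (f : Fin k → Carrier) b → (∀ a → a ≢ b → f a ≈ 0#) → sumFin f ≈ f b
  sumFin-single f Fin.zero f≈0 =
    trans (+-congˡ (sumFin-zero (f ∘ Fin.suc) (λ a → f≈0 (Fin.suc a) (λ ())))) (+-identityʳ _)
  sumFin-single f (Fin.suc b) f≈0 =
    trans (+-cong (f≈0 Fin.zero (λ ()))
                  (sumFin-single (f ∘ Fin.suc) b (λ a a≢b → f≈0 (Fin.suc a) (a≢b ∘ Fin.suc-injective))))
          (+-identityˡ _)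

  sumTuples-zero : ∀ k (f : Vec (Fin n) k → Carrier) → (∀ T → f T ≈ 0#) → sumTuples k f ≈ 0#
  sumTuples-zero zero    f f≈0 = f≈0 []
  sumTuples-zero (suc k) f f≈0 =
    sumFin-zero _ (λ a → sumTuples-zero k (λ T → f (a ∷ T)) (λ T → f≈0 (a ∷ T)))

  sumTuples-single : ∀ k (f : Vec (Fin n) k → Carrier) S → (∀ T → T ≢ S → f T ≈ 0#) → sumTuples k f ≈ f S
  sumTuples-single zero    f []      f≈0 = refl
  sumTuples-single (suc k) f (s ∷ S) f≈0 = trans
    (sumFin-single _ s (λ a a≢s → sumTuples-zero k (λ T → f (a ∷ T)) (λ T → f≈0 (a ∷ T) (a≢s ∘ Vec.∷-injectiveˡ))))
    (sumTuples-single k (λ T → f (s ∷ T)) S (λ T T≢S → f≈0 (s ∷ T) (T≢S ∘ Vec.∷-injectiveʳ)))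

  fromℕ-+ : ∀ i j → fromℕ (i ℕ.+ j) ≈ fromℕ i + fromℕ j
  fromℕ-+ zero    j = sym (+-identityˡ _)
  fromℕ-+ (suc i) j = trans (+-congˡ (fromℕ-+ i j)) (sym (+-assoc _ _ _))

  ζ-++ : ∀ a (u v : Word n) → ζ a ((u ++ v) ∷ []) ≈ ζ a (u ∷ []) + ζ a (v ∷ [])
  ζ-++ a u v = trans (reflexive (≡.cong fromℕ occurrences-++)) (fromℕ-+ (length (filter (_≟ a) u)) _)
    where
    occurrences-++ : length (filter (_≟ a) (u ++ v)) ≡ length (filter (_≟ a) u) ℕ.+ length (filter (_≟ a) v)
    occurrences-++ = ≡.trans (≡.cong length (filter-++ (_≟ a) u v)) (length-++ (filter (_≟ a) u))

  ζ-absent : ∀ {a} w → a ∉ w → ζ a (w ∷ []) ≈ 0#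
  ζ-absent {a} w a∉w = reflexive (≡.cong (fromℕ ∘ length)
    (filter-none (_≟ a) (All.map (_∘ ≡.sym) (All.¬Any⇒All¬ w a∉w))))

  ζ-single : ∀ a → ζ a ([ a ] ∷ []) ≈ 1#
  ζ-single a = trans (reflexive (≡.cong (fromℕ ∘ length) (filter-all (_≟ a) (≡.refl ∷ [])))) (+-identityʳ 1#)

  -- δ unfolded recursively in the first argument, the form in which the shuffle computations use it.
  ∂ : ∀ {q} → Cochain q → Cochain (suc q)
  ∂ {zero}  f _              = 0#
  ∂ {suc q} f (m₀ ∷ m₁ ∷ ms) =
    f (m₁ ∷ ms) - f ((m₀ ++ m₁) ∷ ms) + f (m₀ ∷ ms) - ∂ (λ ys → f (m₀ ∷ ys)) (m₁ ∷ ms)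

  δ≈∂ : ∀ {k} (f : Cochain k) ms → δ f ms ≈ ∂ f ms
  δ≈∂ {zero}  f (m₀ ∷ []) = solve 1 (λ x → x :+ con (+ 0) :+ (:- con (+ 1)) :* x := con (+ 0)) refl (f [])
  δ≈∂ {suc k} f (m₀ ∷ m₁ ∷ ms) = begin
    f (m₁ ∷ ms) + (sign 1 * f ((m₀ ++ m₁) ∷ ms) + Σ₂) + - sign (suc k) * f (m₀ ∷ Vec.init (m₁ ∷ ms))
      ≈⟨ +-congʳ (+-congˡ (+-congˡ Σ₂≈-Σ₁)) ⟩
    f (m₁ ∷ ms) + (sign 1 * f ((m₀ ++ m₁) ∷ ms) - Σ₁) + - sign (suc k) * f (m₀ ∷ Vec.init (m₁ ∷ ms))
      ≈⟨ solve 6 (λ a b c s e σ → a :+ ((:- con (+ 1)) :* b :+ :- σ) :+ (:- s) :* e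
                                   := a :+ :- b :+ c :+ :- (c :+ σ :+ s :* e))
               refl (f (m₁ ∷ ms)) (f ((m₀ ++ m₁) ∷ ms)) (f (m₀ ∷ ms)) (sign (suc k))
               (f (m₀ ∷ Vec.init (m₁ ∷ ms))) Σ₁ ⟩
    f (m₁ ∷ ms) - f ((m₀ ++ m₁) ∷ ms) + f (m₀ ∷ ms) - δ (λ ys → f (m₀ ∷ ys)) (m₁ ∷ ms)
      ≈⟨ +-congˡ (-‿cong (δ≈∂ (λ ys → f (m₀ ∷ ys)) (m₁ ∷ ms))) ⟩
    ∂ f (m₀ ∷ m₁ ∷ ms) ∎
    where
    inner : Fin k → Carrier
    inner i = f (m₀ ∷ merge i (m₁ ∷ ms))
    Σ₁ Σ₂ : Carrier
    Σ₁ = sumFin (λ i → sign (suc (Fin.toℕ i)) * inner i)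
    Σ₂ = sumFin (λ i → sign (suc (suc (Fin.toℕ i))) * inner i)
    Σ₂≈-Σ₁ : Σ₂ ≈ - Σ₁
    Σ₂≈-Σ₁ = trans (sumFin-cong _ (λ i → - (sign (suc (Fin.toℕ i)) * inner i)) (λ i → sym (-‿distribˡ-* _ _)))
                   (sumFin-neg (λ i → sign (suc (Fin.toℕ i)) * inner i))

  δ-degree1 : ∀ (f : Cochain 1) u v → δ f (u ∷ v ∷ []) ≈ f (v ∷ []) - f ((u ++ v) ∷ []) + f (u ∷ [])
  δ-degree1 f u v = trans (δ≈∂ f (u ∷ v ∷ [])) (trans (+-congˡ -0#≈0#) (+-identityʳ _))

  ∂-sub : ∀ {q} (f g : Cochain q) ys → ∂ (λ zs → f zs - g zs) ys ≈ ∂ f ys - ∂ g ys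
  ∂-sub {zero}  f g _                = solve 0 (con (+ 0) := con (+ 0) :+ :- con (+ 0)) refl
  ∂-sub {suc q} f g (m₀ ∷ m₁ ∷ ms) = begin
    (f₁ - g₁) - (f₀₁ - g₀₁) + (f₀ - g₀) - ∂ (λ ys → f (m₀ ∷ ys) - g (m₀ ∷ ys)) (m₁ ∷ ms)
      ≈⟨ +-congˡ (-‿cong (∂-sub (λ ys → f (m₀ ∷ ys)) (λ ys → g (m₀ ∷ ys)) (m₁ ∷ ms))) ⟩
    (f₁ - g₁) - (f₀₁ - g₀₁) + (f₀ - g₀) - (∂f₀ - ∂g₀)
      ≈⟨ solve 8 (λ a a' b b' d d' e e' → (a :+ :- a') :+ :- (b :+ :- b') :+ (d :+ :- d') :+ :- (e :+ :- e')
                   := (a :+ :- b :+ d :+ :- e) :+ :- (a' :+ :- b' :+ d' :+ :- e')) refl f₁ g₁ f₀₁ g₀₁ f₀ g₀ ∂f₀ ∂g₀ ⟩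
    ∂ f (m₀ ∷ m₁ ∷ ms) - ∂ g (m₀ ∷ m₁ ∷ ms) ∎
    where
    f₁ g₁ f₀₁ g₀₁ f₀ g₀ ∂f₀ ∂g₀ : Carrier
    f₁ = f (m₁ ∷ ms); g₁ = g (m₁ ∷ ms)
    f₀₁ = f ((m₀ ++ m₁) ∷ ms); g₀₁ = g ((m₀ ++ m₁) ∷ ms)
    f₀ = f (m₀ ∷ ms); g₀ = g (m₀ ∷ ms)
    ∂f₀ = ∂ (λ ys → f (m₀ ∷ ys)) (m₁ ∷ ms); ∂g₀ = ∂ (λ ys → g (m₀ ∷ ys)) (m₁ ∷ ms)

  _≈[_]_ : ∀ {k} → Cochain k → (Word n → Set) → Cochain k → Set ℓ
  f ≈[ P ] g = ∀ ys → VecAll P ys → f ys ≈ g ys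

  invariant-∷ : ∀ {k} (h : Cochain (suc k)) m → Invariant h → Invariant (λ ys → h (m ∷ ys))
  invariant-∷ h m h-inv ys ys' ys≈ys' = h-inv (m ∷ ys) (m ∷ ys') (≈K-refl ∷ ys≈ys')

  -- insert x f (y₁, …, y_q) = Σᵢ (-1)ⁱ f(y₁, …, yᵢ, x, yᵢ₊₁, …, y_q): the value of f on the
  -- signed shuffle of the 1-chain [x] into [y₁ | ⋯ | y_q].
  insert : Word n → ∀ {q} → Cochain (suc q) → Cochain q
  insert x {zero}  f []       = f (x ∷ [])
  insert x {suc q} f (m ∷ ms) = f (x ∷ m ∷ ms) - insert x (λ ys → f (m ∷ ys)) ms

  insert-cong : ∀ {P} x {q} (f g : Cochain (suc q)) → f ≈[ P ] g → P x → insert x f ≈[ P ] insert x g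
  insert-cong x {zero}  f g f≈g Px []       []           = f≈g (x ∷ []) (Px ∷ [])
  insert-cong x {suc q} f g f≈g Px (m ∷ ms) (Pm ∷ Pms) =
    +-cong (f≈g (x ∷ m ∷ ms) (Px ∷ Pm ∷ Pms))
           (-‿cong (insert-cong x (λ ys → f (m ∷ ys)) (λ ys → g (m ∷ ys))
                                  (λ ys Pys → f≈g (m ∷ ys) (Pm ∷ Pys)) Px ms Pms))

  insert-cong′ : ∀ x {q} (f g : Cochain (suc q)) → (∀ ys → f ys ≈ g ys) → ∀ ys → insert x f ys ≈ insert x g ys
  insert-cong′ x f g f≈g ys =
    insert-cong {P = λ _ → ⊤} x f g (λ ys _ → f≈g ys) tt ys (VecAll.universal (λ _ → tt) ys)

  insert-+ : ∀ x {q} (f g : Cochain (suc q)) ys → insert x (λ zs → f zs + g zs) ys ≈ insert x f ys + insert x g ys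
  insert-+ x {zero}  f g []       = refl
  insert-+ x {suc q} f g (m ∷ ms) = begin
    f (x ∷ m ∷ ms) + g (x ∷ m ∷ ms) - insert x (λ zs → f (m ∷ zs) + g (m ∷ zs)) ms
      ≈⟨ +-congˡ (-‿cong (insert-+ x (λ zs → f (m ∷ zs)) (λ zs → g (m ∷ zs)) ms)) ⟩
    f (x ∷ m ∷ ms) + g (x ∷ m ∷ ms) - (insert x (λ zs → f (m ∷ zs)) ms + insert x (λ zs → g (m ∷ zs)) ms)
      ≈⟨ solve 4 (λ a b c d → a :+ b :+ :- (c :+ d) := (a :+ :- c) :+ (b :+ :- d)) refl _ _ _ _ ⟩
    insert x f (m ∷ ms) + insert x g (m ∷ ms) ∎

  insert-neg : ∀ x {q} (f : Cochain (suc q)) ys → insert x (λ zs → - f zs) ys ≈ - insert x f ys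
  insert-neg x {zero}  f []       = refl
  insert-neg x {suc q} f (m ∷ ms) = begin
    - f (x ∷ m ∷ ms) - insert x (λ zs → - f (m ∷ zs)) ms  ≈⟨ +-congˡ (-‿cong (insert-neg x (λ zs → f (m ∷ zs)) ms)) ⟩
    - f (x ∷ m ∷ ms) - - insert x (λ zs → f (m ∷ zs)) ms  ≈⟨ solve 2 (λ a b → :- a :+ :- (:- b) := :- (a :+ :- b)) refl _ _ ⟩
    - insert x f (m ∷ ms)                                 ∎

  insert-sub : ∀ x {q} (f g : Cochain (suc q)) ys → insert x (λ zs → f zs - g zs) ys ≈ insert x f ys - insert x g ys
  insert-sub x f g ys = trans (insert-+ x f (λ zs → - g zs) ys) (+-congˡ (insert-neg x g ys))

  insert-0 : ∀ x {q} ys → insert x {q} (λ _ → 0#) ys ≈ 0#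
  insert-0 x {zero}  []       = refl
  insert-0 x {suc q} (m ∷ ms) = trans (+-congˡ (trans (-‿cong (insert-0 x ms)) -0#≈0#)) (+-identityʳ 0#)

  insert-invariant : ∀ x {q} (h : Cochain (suc q)) → Invariant h → Invariant (insert x h)
  insert-invariant x {zero}  h h-inv []       []         []                  = refl
  insert-invariant x {suc q} h h-inv (m ∷ ms) (m' ∷ ms') (m≈m' ∷ ms≈ms') =
    +-cong (h-inv _ _ (≈K-refl ∷ m≈m' ∷ ms≈ms'))
           (-‿cong (trans (insert-invariant x (λ ys → h (m ∷ ys)) (invariant-∷ h m h-inv) ms ms' ms≈ms')
                          (insert-cong′ x _ _ (λ ys → h-inv (m ∷ ys) (m' ∷ ys) (m≈m' ∷ Pointwise.refl ≈K-refl)) ms')))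

  insert-∂ : ∀ x {q} (h : Cochain (suc q)) → Invariant h →
             insert x (∂ h) ≈[ Commute x ] (λ ys → - ∂ (insert x h) ys)
  insert-∂ x {zero} h h-inv (m ∷ []) (xm≈mx ∷ []) =
    trans (+-congʳ (+-congʳ (+-congʳ (+-congˡ (-‿cong (h-inv _ _ (xm≈mx ∷ [])))))))
          (solve 4 (λ a b c z → a :+ :- b :+ c :+ :- z :+ :- (c :+ :- b :+ a :+ :- z) := :- con (+ 0)) refl _ _ _ _)
  insert-∂ x {suc q} h h-inv (m₁ ∷ m₂ ∷ ms) (xm₁≈m₁x ∷ x∘m₂ ∷ x∘ms) = begin
    (A₁ - A₂ + A₃ - (A₃ - A₄ + A₅ - A₆)) - ((A₃ - A₂′ + A₁ - A₇) - insert x (λ ys → ∂ h (m₁ ∷ m₂ ∷ ys)) ms)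
      ≈⟨ +-congˡ (-‿cong (+-cong (+-congʳ (+-congʳ (+-congˡ (-‿cong (sym A₂≈A₂′))))) (-‿cong expand))) ⟩
    (A₁ - A₂ + A₃ - (A₃ - A₄ + A₅ - A₆)) - ((A₃ - A₂ + A₁ - A₇) - (B₁ - B₂ + B₃ - B₄))
      ≈⟨ solve 11 (λ A₁ A₂ A₃ A₄ A₅ A₆ A₇ B₁ B₂ B₃ B₄ →
           (A₁ :+ :- A₂ :+ A₃ :+ :- (A₃ :+ :- A₄ :+ A₅ :+ :- A₆))
             :+ :- ((A₃ :+ :- A₂ :+ A₁ :+ :- A₇) :+ :- (B₁ :+ :- B₂ :+ B₃ :+ :- B₄))
           := (A₄ :+ :- A₅ :+ A₆ :+ :- A₃ :+ B₁ :+ :- B₂ :+ B₃) :+ (A₇ :+ :- B₄))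
         refl A₁ A₂ A₃ A₄ A₅ A₆ A₇ B₁ B₂ B₃ B₄ ⟩
    (A₄ - A₅ + A₆ - A₃ + B₁ - B₂ + B₃) + (A₇ - B₄)
      ≈⟨ +-congˡ (insert-∂ x (λ ys → h (m₁ ∷ ys)) (invariant-∷ h m₁ h-inv) (m₂ ∷ ms) (x∘m₂ ∷ x∘ms)) ⟩
    (A₄ - A₅ + A₆ - A₃ + B₁ - B₂ + B₃) - E
      ≈⟨ solve 8 (λ A₃ A₄ A₅ A₆ B₁ B₂ B₃ E →
           (A₄ :+ :- A₅ :+ A₆ :+ :- A₃ :+ B₁ :+ :- B₂ :+ B₃) :+ :- E
           := :- ((A₃ :+ :- B₁) :+ :- (A₄ :+ :- B₂) :+ (A₅ :+ :- B₃) :+ :- (A₆ :+ :- E))) refl A₃ A₄ A₅ A₆ B₁ B₂ B₃ E ⟩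
    - ((A₃ - B₁) - (A₄ - B₂) + (A₅ - B₃) - (A₆ - E))
      ≈⟨ -‿cong (+-congˡ (-‿cong (∂-sub (λ ys → h (x ∷ m₁ ∷ ys)) (insert x (λ ys → h (m₁ ∷ ys))) (m₂ ∷ ms)))) ⟨
    - ∂ (insert x h) (m₁ ∷ m₂ ∷ ms) ∎
    where
    A₁ A₂ A₂′ A₃ A₄ A₅ A₆ A₇ B₁ B₂ B₃ B₄ E : Carrier
    A₁ = h (m₁ ∷ m₂ ∷ ms)
    A₂ = h ((x ++ m₁) ∷ m₂ ∷ ms)
    A₂′ = h ((m₁ ++ x) ∷ m₂ ∷ ms)
    A₃ = h (x ∷ m₂ ∷ ms)
    A₄ = h (x ∷ (m₁ ++ m₂) ∷ ms)
    A₅ = h (x ∷ m₁ ∷ ms)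
    A₆ = ∂ (λ ys → h (x ∷ m₁ ∷ ys)) (m₂ ∷ ms)
    A₇ = ∂ (λ ys → h (m₁ ∷ ys)) (x ∷ m₂ ∷ ms)
    h₂ h₁₂ h₁ ∂h₁ : Cochain (suc q)
    h₂ ys = h (m₂ ∷ ys)
    h₁₂ ys = h ((m₁ ++ m₂) ∷ ys)
    h₁ ys = h (m₁ ∷ ys)
    ∂h₁ ys = ∂ (λ zs → h (m₁ ∷ zs)) (m₂ ∷ ys)
    B₁ = insert x h₂ ms
    B₂ = insert x h₁₂ ms
    B₃ = insert x h₁ ms
    B₄ = insert x ∂h₁ ms
    E = ∂ (insert x (λ ys → h (m₁ ∷ ys))) (m₂ ∷ ms)
    A₂≈A₂′ : A₂ ≈ A₂′
    A₂≈A₂′ = h-inv _ _ (xm₁≈m₁x ∷ Pointwise.refl ≈K-refl)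
    expand : insert x (λ ys → ∂ h (m₁ ∷ m₂ ∷ ys)) ms ≈ B₁ - B₂ + B₃ - B₄
    expand = begin
      insert x (λ ys → h₂ ys - h₁₂ ys + h₁ ys - ∂h₁ ys) ms  ≈⟨ insert-sub x (λ ys → h₂ ys - h₁₂ ys + h₁ ys) ∂h₁ ms ⟩
      insert x (λ ys → h₂ ys - h₁₂ ys + h₁ ys) ms - B₄       ≈⟨ +-congʳ (insert-+ x (λ ys → h₂ ys - h₁₂ ys) h₁ ms) ⟩
      insert x (λ ys → h₂ ys - h₁₂ ys) ms + B₃ - B₄          ≈⟨ +-congʳ (+-congʳ (insert-sub x h₂ h₁₂ ms)) ⟩
      B₁ - B₂ + B₃ - B₄                                      ∎

  -- The value of f on the signed shuffle product [x₁] ⧢ ⋯ ⧢ [x_k] of 1-chains.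
  shuffleValue : ∀ {k} → Vec (Word n) k → Cochain k → Carrier
  shuffleValue []       f = f []
  shuffleValue (x ∷ xs) f = shuffleValue xs (insert x f)

  shuffleValue-cong : ∀ {P k} (xs : Vec (Word n) k) (f g : Cochain k) → f ≈[ P ] g → VecAll P xs →
                      shuffleValue xs f ≈ shuffleValue xs g
  shuffleValue-cong []       f g f≈g _           = f≈g [] []
  shuffleValue-cong (x ∷ xs) f g f≈g (Px ∷ Pxs) =
    shuffleValue-cong xs (insert x f) (insert x g) (insert-cong x f g f≈g Px) Pxs

  shuffleValue-cong′ : ∀ {k} (xs : Vec (Word n) k) (f g : Cochain k) → (∀ ys → f ys ≈ g ys) →
                       shuffleValue xs f ≈ shuffleValue xs g
  shuffleValue-cong′ xs f g f≈g =
    shuffleValue-cong {P = λ _ → ⊤} xs f g (λ ys _ → f≈g ys) (VecAll.universal (λ _ → tt) xs)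

  shuffleValue-neg : ∀ {k} (xs : Vec (Word n) k) (f : Cochain k) →
                     shuffleValue xs (λ ys → - f ys) ≈ - shuffleValue xs f
  shuffleValue-neg []       f = refl
  shuffleValue-neg (x ∷ xs) f =
    trans (shuffleValue-cong′ xs _ _ (insert-neg x f)) (shuffleValue-neg xs (insert x f))

  shuffleValue-∂ : ∀ {k} (xs : Vec (Word n) (suc k)) (h : Cochain k) → Invariant h →
                   VecAllPairs.AllPairs Commute xs → shuffleValue xs (∂ h) ≈ 0#
  shuffleValue-∂ {zero}  (x ∷ []) h _     _              = refl
  shuffleValue-∂ {suc k} (x ∷ xs) h h-inv (x∘xs ∷ xs∘xs) = begin
    shuffleValue xs (insert x (∂ h))              ≈⟨ shuffleValue-cong xs _ _ (insert-∂ x h h-inv) x∘xs ⟩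
    shuffleValue xs (λ ys → - ∂ (insert x h) ys)  ≈⟨ shuffleValue-neg xs _ ⟩
    - shuffleValue xs (∂ (insert x h))
      ≈⟨ -‿cong (shuffleValue-∂ xs (insert x h) (insert-invariant x h h-inv) xs∘xs) ⟩
    - 0#                                          ≈⟨ -0#≈0# ⟩
    0#                                            ∎

  data Triangular : ∀ {k} → Vec (Fin n) k → Vec (Word n) k → Set ℓ where
    []  : Triangular [] []
    _∷_ : ∀ {k a x} {as : Vec (Fin n) k} {xs} →
          (ζ a (x ∷ []) ≈ 1#) × VecAll (λ w → ζ a (w ∷ []) ≈ 0#) xs →
          Triangular as xs → Triangular (a ∷ as) (x ∷ xs)

  insert-triangular : ∀ {k a x} {as : Vec (Fin n) k} {xs : Vec (Word n) k} (f : Cochain (suc k)) r →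
    ζ a (x ∷ []) ≈ 1# → VecAll (λ w → ζ a (w ∷ []) ≈ 0#) xs →
    f ≈[ _∈ᵥ (x ∷ xs) ] (λ ys → r * ζ* (a ∷ as) ys) →
    insert x f ≈[ _∈ᵥ xs ] (λ ys → r * ζ* as ys)
  insert-triangular {as = []} f r ζₐx≈1 _ f≈rζ [] [] =
    trans (f≈rζ _ (here ≡.refl ∷ [])) (*-congˡ (trans (*-congʳ ζₐx≈1) (*-identityˡ 1#)))
  insert-triangular {a = a} {x} {as = b ∷ as} {xs} f r ζₐx≈1 ζₐxs≈0 f≈rζ (m ∷ ms) (m∈xs ∷ ms∈xs) = begin
    f (x ∷ m ∷ ms) - insert x (λ ys → f (m ∷ ys)) ms
      ≈⟨ +-cong (f≈rζ _ (here ≡.refl ∷ there m∈xs ∷ VecAll.map there ms∈xs))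
                (-‿cong (trans (insert-cong x _ _ f-m≈0 (here ≡.refl) ms (VecAll.map there ms∈xs)) (insert-0 x ms))) ⟩
    r * (ζ a (x ∷ []) * ζ* (b ∷ as) (m ∷ ms)) - 0#
      ≈⟨ +-cong (*-congˡ (trans (*-congʳ ζₐx≈1) (*-identityˡ _))) -0#≈0# ⟩
    r * ζ* (b ∷ as) (m ∷ ms) + 0#
      ≈⟨ +-identityʳ _ ⟩
    r * ζ* (b ∷ as) (m ∷ ms) ∎
    where
    f-m≈0 : (λ ys → f (m ∷ ys)) ≈[ _∈ᵥ (x ∷ xs) ] (λ _ → 0#)
    f-m≈0 ys ys∈ = trans (f≈rζ (m ∷ ys) (there m∈xs ∷ ys∈))
      (trans (*-congˡ (trans (*-congʳ (VecAll.lookup ζₐxs≈0 m∈xs)) (zeroˡ _))) (zeroʳ _))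

  shuffleValue-triangular : ∀ {k} {as : Vec (Fin n) k} {xs : Vec (Word n) k} (f : Cochain k) r → Triangular as xs →
    f ≈[ _∈ᵥ xs ] (λ ys → r * ζ* as ys) → shuffleValue xs f ≈ r
  shuffleValue-triangular f r []                   f≈rζ = trans (f≈rζ [] []) (*-identityʳ r)
  shuffleValue-triangular {as = _ ∷ as} {x ∷ _} f r ((ζₐx≈1 , ζₐxs≈0) ∷ tri) f≈rζ =
    shuffleValue-triangular (insert x f) r tri (insert-triangular {as = as} f r ζₐx≈1 ζₐxs≈0 f≈rζ)

  columns-triangular : ∀ {k} (S : Vec (Fin n) k) → AllPairs _<_ (toList S) → Triangular S (columns S)
  columns-triangular []      []           = []
  columns-triangular (s ∷ S) (s<S ∷ S↑) =
    (ζₛ-column≈1 , VecAll.map (ζ-absent _ ∘ ∉-above) (columns-All s<S)) ∷ columns-triangular S S↑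
    where
    ∉-above : ∀ {w} → All (s <_) w → s ∉ w
    ∉-above s<w s∈w = Fin.<-irrefl ≡.refl (All.lookup s<w s∈w)
    ζₛ-column≈1 : ζ s (column (s ∷ toList S) ∷ []) ≈ 1#
    ζₛ-column≈1 = begin
      ζ s ((column (toList S) ++ [ s ]) ∷ [])          ≈⟨ ζ-++ s (column (toList S)) [ s ] ⟩
      ζ s (column (toList S) ∷ []) + ζ s ([ s ] ∷ [])  ≈⟨ +-cong (ζ-absent _ (∉-above (column-All s<S))) (ζ-single s) ⟩
      0# + 1#                                          ≈⟨ +-identityˡ 1# ⟩
      1#                                               ∎

  ζ*≈0⊎occurs : ∀ {k} (T : Vec (Fin n) k) ys → ζ* T ys ≈ 0# ⊎ Pointwise _∈_ T ys
  ζ*≈0⊎occurs []      []       = inj₂ []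
  ζ*≈0⊎occurs (t ∷ T) (y ∷ ys) with t ∈? y | ζ*≈0⊎occurs T ys
  ... | no t∉y | _             = inj₁ (trans (*-congʳ (ζ-absent y t∉y)) (zeroˡ _))
  ... | yes _  | inj₁ ζ*T≈0   = inj₁ (trans (*-congˡ ζ*T≈0) (zeroʳ _))
  ... | yes t∈y | inj₂ T∈ys   = inj₂ (t∈y ∷ T∈ys)

  occurring-letters : ∀ {P : Fin n → Set} {k} {T : Vec (Fin n) k} {ys : Vec (Word n) k} →
    Pointwise _∈_ T ys → VecAll (All P) ys → All P (toList T)
  occurring-letters []             []           = []
  occurring-letters (t∈y ∷ T∈ys) (Py ∷ Pys) = All.lookup Py t∈y ∷ occurring-letters T∈ys Pys

  sumTuples-on-columns : ∀ {k} (cf : Vec (Fin n) k → Carrier) → (∀ T → ¬ StrictlyIncreasing T → cf T ≈ 0#) →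
    ∀ S → StrictlyIncreasing S →
    (λ ys → sumTuples k (λ T → cf T * ζ* T ys)) ≈[ _∈ᵥ columns S ] (λ ys → cf S * ζ* S ys)
  sumTuples-on-columns {k} cf cf-increasing S S↑ ys ys∈ = sumTuples-single k _ S term-vanishes
    where
    term-vanishes : ∀ T → T ≢ S → cf T * ζ* T ys ≈ 0#
    term-vanishes T T≢S with linked? Fin._<?_ (toList T) | ζ*≈0⊎occurs T ys
    ... | no ¬T↑ | _          = trans (*-congʳ (cf-increasing T ¬T↑)) (zeroˡ _)
    ... | yes _  | inj₁ ζ*T≈0 = trans (*-congˡ ζ*T≈0) (zeroʳ _)
    ... | yes T↑ | inj₂ T∈ys  =
      ⊥-elim (T≢S (increasing-⊆⇒≡ T S (Linked⇒AllPairs Fin.<-trans T↑) (Linked⇒AllPairs Fin.<-trans S↑) T⊆S))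
      where
      T⊆S : All (_∈ toList S) (toList T)
      T⊆S = occurring-letters T∈ys (VecAll.map (VecAll.lookup (columns-All (All.tabulate id))) ys∈)

  ζ-isCocycle : ∀ a → IsCocycle (ζ a)
  ζ-isCocycle a (u ∷ v ∷ []) = begin
    δ (ζ a) (u ∷ v ∷ [])                               ≈⟨ δ-degree1 (ζ a) u v ⟩
    ζ a (v ∷ []) - ζ a ((u ++ v) ∷ []) + ζ a (u ∷ [])  ≈⟨ +-congʳ (+-congˡ (-‿cong (ζ-++ a u v))) ⟩
    ζ a (v ∷ []) - (ζ a (u ∷ []) + ζ a (v ∷ [])) + ζ a (u ∷ [])
      ≈⟨ solve 2 (λ p q → q :+ :- (p :+ q) :+ p := con (+ 0)) refl (ζ a (u ∷ [])) (ζ a (v ∷ [])) ⟩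
    0#                                                 ∎

  module Square (r : Fin n → Carrier) where

    ζ[r] : Cochain 1
    ζ[r] ms = sumFin (λ a → r a * ζ a ms)

    X : Word n → Carrier
    X w = ζ[r] (w ∷ [])

    X-++ : ∀ u v → X (u ++ v) ≈ X u + X v
    X-++ u v = trans (sumFin-cong _ _ (λ a → trans (*-congˡ (ζ-++ a u v)) (distribˡ _ _ _)))
                     (sumFin-+ (λ a → r a * ζ a (u ∷ [])) (λ a → r a * ζ a (v ∷ [])))

    X-[] : X [] ≈ 0#
    X-[] = sumFin-zero _ (λ a → zeroʳ (r a))

    e₂ : Word n → Carrier
    e₂ []      = 0#
    e₂ (a ∷ w) = X [ a ] * X w + e₂ w

    e₂-++ : ∀ u v → e₂ (u ++ v) ≈ e₂ u + X u * X v + e₂ v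
    e₂-++ [] v = begin
      e₂ v                    ≈⟨ solve 2 (λ x e → e := con (+ 0) :+ con (+ 0) :* x :+ e) refl (X v) (e₂ v) ⟩
      0# + 0# * X v + e₂ v    ≈⟨ +-congʳ (+-congˡ (*-congʳ (sym X-[]))) ⟩
      0# + X [] * X v + e₂ v  ∎
    e₂-++ (a ∷ u) v = begin
      X [ a ] * X (u ++ v) + e₂ (u ++ v)                   ≈⟨ +-cong (*-congˡ (X-++ u v)) (e₂-++ u v) ⟩
      X [ a ] * (X u + X v) + (e₂ u + X u * X v + e₂ v)
        ≈⟨ solve 5 (λ A U V E F → A :* (U :+ V) :+ (E :+ U :* V :+ F) := A :* U :+ E :+ (A :+ U) :* V :+ F)
                   refl _ _ _ _ _ ⟩
      X [ a ] * X u + e₂ u + (X [ a ] + X u) * X v + e₂ v  ≈⟨ +-congʳ (+-congˡ (*-congʳ (sym (X-++ [ a ] u)))) ⟩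
      e₂ (a ∷ u) + X (a ∷ u) * X v + e₂ v                  ∎

    e₂-swap : ∀ p q v → e₂ (p ∷ q ∷ v) ≈ e₂ (q ∷ p ∷ v)
    e₂-swap p q v = begin
      X [ p ] * X (q ∷ v) + (X [ q ] * X v + e₂ v)        ≈⟨ +-congʳ (*-congˡ (X-++ [ q ] v)) ⟩
      X [ p ] * (X [ q ] + X v) + (X [ q ] * X v + e₂ v)
        ≈⟨ solve 4 (λ P Q V E → P :* (Q :+ V) :+ (Q :* V :+ E) := Q :* (P :+ V) :+ (P :* V :+ E)) refl _ _ _ _ ⟩
      X [ q ] * (X [ p ] + X v) + (X [ p ] * X v + e₂ v)  ≈⟨ +-congʳ (*-congˡ (X-++ [ p ] v)) ⟨
      X [ q ] * X (p ∷ v) + (X [ p ] * X v + e₂ v)        ∎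

    X-swap : ∀ p q v → X (p ∷ q ∷ v) ≈ X (q ∷ p ∷ v)
    X-swap p q v = begin
      X (p ∷ q ∷ v)              ≈⟨ trans (X-++ [ p ] (q ∷ v)) (+-congˡ (X-++ [ q ] v)) ⟩
      X [ p ] + (X [ q ] + X v)  ≈⟨ solve 3 (λ P Q V → P :+ (Q :+ V) := Q :+ (P :+ V)) refl _ _ _ ⟩
      X [ q ] + (X [ p ] + X v)  ≈⟨ trans (X-++ [ q ] (p ∷ v)) (+-congˡ (X-++ [ p ] v)) ⟨
      X (q ∷ p ∷ v)              ∎

    e₂-transposition : ∀ u p q v → e₂ (u ++ p ∷ q ∷ v) ≈ e₂ (u ++ q ∷ p ∷ v)
    e₂-transposition u p q v = begin
      e₂ (u ++ p ∷ q ∷ v)                          ≈⟨ e₂-++ u (p ∷ q ∷ v) ⟩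
      e₂ u + X u * X (p ∷ q ∷ v) + e₂ (p ∷ q ∷ v)  ≈⟨ +-cong (+-congˡ (*-congˡ (X-swap p q v))) (e₂-swap p q v) ⟩
      e₂ u + X u * X (q ∷ p ∷ v) + e₂ (q ∷ p ∷ v)  ≈⟨ e₂-++ u (q ∷ p ∷ v) ⟨
      e₂ (u ++ q ∷ p ∷ v)                          ∎

    e₂-invariant : ∀ {w w'} → w ≈K w' → e₂ w ≈ e₂ w'
    e₂-invariant = transposition-invariant⇒≈K-invariant setoid e₂ e₂-transposition

    -e₂ : Cochain 1
    -e₂ (w ∷ []) = - e₂ w

    -e₂-invariant : Invariant -e₂
    -e₂-invariant (w ∷ []) (w' ∷ []) (w≈w' ∷ []) = -‿cong (e₂-invariant w≈w')

    δ-e₂≈ζ[r]∪ζ[r] : ∀ ms → δ -e₂ ms ≈ (ζ[r] ∪ ζ[r]) ms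
    δ-e₂≈ζ[r]∪ζ[r] (u ∷ v ∷ []) = begin
      δ -e₂ (u ∷ v ∷ [])               ≈⟨ δ-degree1 -e₂ u v ⟩
      - e₂ v - - e₂ (u ++ v) + - e₂ u  ≈⟨ +-congʳ (+-congˡ (-‿cong (-‿cong (e₂-++ u v)))) ⟩
      - e₂ v - - (e₂ u + X u * X v + e₂ v) + - e₂ u
        ≈⟨ solve 4 (λ E U V F → :- F :+ :- (:- (E :+ U :* V :+ F)) :+ :- E := U :* V) refl (e₂ u) (X u) (X v) (e₂ v) ⟩
      X u * X v                        ∎

  ζ[r]∪ζ[r]-isCoboundary : ∀ r → IsCoboundary 2 (Square.ζ[r] r ∪ Square.ζ[r] r)
  ζ[r]∪ζ[r]-isCoboundary r = -e₂ , -e₂-invariant , δ-e₂≈ζ[r]∪ζ[r]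
    where open Square r

  ζ*-independent : ∀ k (cf : Vec (Fin n) k → Carrier) → (∀ S → ¬ StrictlyIncreasing S → cf S ≈ 0#) →
    IsCoboundary k (λ ms → sumTuples k (λ S → cf S * ζ* S ms)) → ∀ S → cf S ≈ 0#
  ζ*-independent zero    cf _            (lift F≈0)           [] = trans (sym (*-identityʳ _)) (F≈0 [])
  ζ*-independent (suc k) cf cf-increasing (g , g-inv , δg≈F) S with linked? Fin._<?_ (toList S)
  ... | no ¬S↑ = cf-increasing S ¬S↑
  ... | yes S↑ = begin
    cf S                            ≈⟨ value-on-columns ⟨
    shuffleValue (columns S) F      ≈⟨ shuffleValue-cong′ (columns S) F (∂ g) F≈∂g ⟩
    shuffleValue (columns S) (∂ g)  ≈⟨ shuffleValue-∂ (columns S) g g-inv (columns-commute S S↑′) ⟩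
    0#                              ∎
    where
    S↑′ : AllPairs _<_ (toList S)
    S↑′ = Linked⇒AllPairs Fin.<-trans S↑
    F : Cochain (suc k)
    F ms = sumTuples (suc k) (λ T → cf T * ζ* T ms)
    F≈∂g : ∀ ms → F ms ≈ ∂ g ms
    F≈∂g ms = trans (sym (δg≈F ms)) (δ≈∂ g ms)
    value-on-columns : shuffleValue (columns S) F ≈ cf S
    value-on-columns = shuffleValue-triangular F (cf S) (columns-triangular S S↑′)
                                               (sumTuples-on-columns cf cf-increasing S S↑)

theorem7p2 : ∀ {c ℓ} (R : CommutativeRing c ℓ) (n : ℕ) →
  let open CommutativeRing R
      open Hochschild R n
  in
  -- the ζ_a are cocycles (so define classes in H¹)
  (∀ (a : Fin n) → IsCocycle (ζ a))
  -- exterior relation: x ∪ x is a coboundary for every x = Σ_a r_a ζ_a,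
  -- so a ↦ [ζ_a] extends to an algebra map Λ(RA) → H*(Pl_A; R)
  × (∀ (r : Fin n → Carrier) →
       IsCoboundary 2 ((λ ms → sumFin (λ a → r a * ζ a ms)) ∪ (λ ms → sumFin (λ a → r a * ζ a ms))))
  -- injectivity: if Σ_{S increasing} c_S ζ_S is a coboundary then all c_S = 0
  × (∀ (k : ℕ) (cf : Vec (Fin n) k → Carrier) →
       (∀ S → ¬ StrictlyIncreasing S → cf S ≈ 0#) →
       IsCoboundary k (λ ms → sumTuples k (λ S → cf S * ζ* S ms)) →
       ∀ S → cf S ≈ 0#)
theorem7p2 R n = ζ-isCocycle , ζ[r]∪ζ[r]-isCoboundary , ζ*-independent
  where open Cohomology R n
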